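{- Let $r<s\le N/2$ be positive integers with $\gcd(r,s,N)=1$, and let $\mathcal T$ be the planar dual of the infinite quiver $\widetilde Q$ below, with each face labeled by the label of the corresponding vertex. Then for $1\le i\le r$ and for $N-r+1\le i\le N$, the faces of $\mathcal T$ labeled $i$ are quadrilaterals (squares), and all other faces of $\mathcal T$ are hexagons.
   Context: For $(A,B)\in\mathbb{Z}^2$ let $\lambda(A,B)\in\{1,\dots,N\}$ be the residue of $1+Ar+Bs$ mod $N$. $\widetilde Q$ has vertex set $\mathbb{Z}^2$, vertex $(A,B)$ labeled $\lambda(A,B)$, an arrow between $(A,B)$ and $(A+1,B)$ oriented from the smaller label to the larger, an arrow between $(A,B)$ and $(A,B+1)$ oriented from the larger label to the smaller, and in each unit square whose lower-left, upper-left, upper-right, lower-right corners have labels $i,i+s,i+r+s,i+r$ (mod $N$, $i\in\{1,\dots,N\}$): a diagonal arrow from the corner labeled $i+r$ to the corner labeled $i+s$ if $i+r+s\le N$, a diagonal arrow from the corner labeled $i+r+s-N$ to the corner labeled $i$ if $i+r\le N<i+s$, and no diagonal otherwise. The resulting planar embedded graph has all bounded regions triangles or squares; $\mathcal T$ is its planar dual. -}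

module Defs where

open import Data.Nat as ℕ using (ℕ; zero; suc; NonZero)
open import Data.Integer as ℤ using (ℤ; +_; _%ℕ_)
open import Data.Bool using (Bool; true; false; _∧_; _∨_; T)
open import Data.Product using (_×_; _,_; Σ)
open import Data.Sum using (_⊎_)
open import Relation.Nullary.Decidable using (⌊_⌋)

Vertex : Set
Vertex = ℤ × ℤ

-- residue of an integer x mod N taken in {1,…,N}
-- (x ≡ 1 + ((x - 1) mod N), and 1 + ((x-1) mod N) ∈ {1,…,N})
res1 : (N : ℕ) .{{_ : NonZero N}} → ℤ → ℕ
res1 N x = suc ((x ℤ.- ℤ.1ℤ) %ℕ N)

lab : (N r s : ℕ) .{{_ : NonZero N}} → Vertex → ℕ
lab N r s (A , B) = res1 N (ℤ.1ℤ ℤ.+ A ℤ.* + r ℤ.+ B ℤ.* + s)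

-- Diagonals in the unit square with lower-left corner (A,B), i = λ(A,B):
-- case 1 (i + r + s ≤ N): arrow from lower-right (A+1,B) to upper-left (A,B+1);
-- case 2 (i + r ≤ N < i + s): arrow from upper-right (A+1,B+1) to lower-left (A,B).
diag₁ : (N r s : ℕ) .{{_ : NonZero N}} → Vertex → Bool
diag₁ N r s p = ⌊ lab N r s p ℕ.+ r ℕ.+ s ℕ.≤? N ⌋

diag₂ : (N r s : ℕ) .{{_ : NonZero N}} → Vertex → Bool
diag₂ N r s p = ⌊ lab N r s p ℕ.+ r ℕ.≤? N ⌋ ∧ ⌊ N ℕ.<? lab N r s p ℕ.+ s ⌋

_==_ : ℤ → ℤ → Bool
x == y = ⌊ x ℤ.≟ y ⌋

arrow : (N r s : ℕ) .{{_ : NonZero N}} → Vertex → Vertex → Bool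
arrow N r s (a , b) (c , d) =
  ((b == d) ∧ ((c == (a ℤ.+ ℤ.1ℤ)) ∨ (a == (c ℤ.+ ℤ.1ℤ)))
     ∧ ⌊ lab N r s (a , b) ℕ.<? lab N r s (c , d) ⌋)
  ∨ ((a == c) ∧ ((d == (b ℤ.+ ℤ.1ℤ)) ∨ (b == (d ℤ.+ ℤ.1ℤ)))
     ∧ ⌊ lab N r s (c , d) ℕ.<? lab N r s (a , b) ⌋)
  -- case-1 diagonal: v = (A+1,B), w = (A,B+1) in the square with lower-left (A,B)
  ∨ ((a == (c ℤ.+ ℤ.1ℤ)) ∧ (d == (b ℤ.+ ℤ.1ℤ)) ∧ diag₁ N r s (c , b))
  -- case-2 diagonal: v = (A+1,B+1), w = (A,B) in the square with lower-left (A,B)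
  ∨ ((a == (c ℤ.+ ℤ.1ℤ)) ∧ (b == (d ℤ.+ ℤ.1ℤ)) ∧ diag₂ N r s (c , d))

-- The edges of the planar embedded graph incident to the vertex v,
-- represented by their other endpoint (Q̃ has no loops, and at most one arrow
-- between any two vertices, by construction).
IncidentEdges : (N r s : ℕ) .{{_ : NonZero N}} → Vertex → Set
IncidentEdges N r s v = Σ Vertex (λ w → T (arrow N r s v w ∨ arrow N r s w v))

-- In the planar dual 𝒯, the face dual to the vertex v (carrying the label
-- λ(v)) has one side for each edge incident to v.
FaceSides : (N r s : ℕ) .{{_ : NonZero N}} → Vertex → Set
FaceSides = IncidentEdges

-- The label of (A , B) is 1 + A r + B s reduced into {1,…,N}, so a step east
-- (north) adds r (s) to the label modulo N.  The sides of the face of 𝒯 dual to v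
-- are the edges at v, each joining v to one of its eight lattice neighbours.  The
-- four axis edges are always there, since 0 < r, s < N makes adjacent labels
-- distinct.  Translated to the label i of v, the diagonal towards the NE, NW, SW,
-- SE neighbour is present iff N − s < i ≤ N − r, r < i ≤ N − s, r < i ≤ s,
-- s < i ≤ N − r respectively.  Each of these forces r < i ≤ N − r, so the faces
-- with i ≤ r or i > N − r are squares; for r < i ≤ N − r exactly one of NE, NW and
-- exactly one of SW, SE is present, so the face is a hexagon.

module Submission where

open import Defs
open import Data.Nat using (ℕ; suc; _≤_; _<_; _*_; _∸_; NonZero)
open import Data.Nat.GCD using (gcd)
open import Data.Fin using (Fin)
open import Data.Product using (_×_)
open import Data.Sum using (_⊎_)
open import Relation.Nullary using (¬_)
open import Relation.Binary.PropositionalEquality using (_≡_)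
open import Function.Bundles using (_↔_)

open import Data.Nat using (zero; z≤n; s≤s; _+_; _<?_; _≤?_)
open import Data.Nat.Properties
open import Data.Integer as ℤ using (ℤ; +_; +[1+_]; -[1+_]; 0ℤ; 1ℤ; -1ℤ; _%ℕ_; _/ℕ_)
import Data.Integer.Properties as ℤP
open import Data.Integer.DivMod using (n%ℕd<d; a≡a%ℕn+[a/ℕn]*n)
open import Data.Integer.Tactic.RingSolver using (solve-∀)
open import Algebra.Properties.CommutativeSemigroup +-commutativeSemigroup using (xy∙z≈xz∙y)
open import Algebra.Properties.AbelianGroup ℤP.+-0-abelianGroup using (∙-cancelˡ)
open import Data.Bool using (Bool; true; false; T; _∧_; _∨_; if_then_else_)
open import Data.Bool.Properties using (T-irrelevant; ∨-identityʳ; ∨-zeroʳ)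
open import Data.Fin.Properties using (0↔⊥; 1↔⊤; +↔⊎)
open import Data.Product using (Σ; ∃-syntax; _,_; proj₁; proj₂)
open import Data.Product.Properties using (Σ-≡,≡→≡)
open import Data.Sum using (inj₁; inj₂)
open import Data.Sum.Function.Propositional using (_⊎-↔_)
open import Data.Unit using (⊤; tt)
open import Function using (_∘_)
open import Function.Bundles using (_⇔_; mk⇔; mk↔ₛ′; module Equivalence)
open import Function.Definitions using (Injective)
open import Function.Properties.Inverse using (↔-trans; ↔-sym)
open import Relation.Nullary using (Dec; yes; no; contradiction)
open import Relation.Nullary.Decidable using (⌊_⌋; _×-dec_)
open import Relation.Binary.PropositionalEquality
  using (_≢_; ≢-sym; refl; sym; trans; cong; cong₂; subst; module ≡-Reasoning)

count : ∀ {n} → (Fin n → Bool) → ℕ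
count {zero}  p = 0
count {suc n} p = (if p Fin.zero then 1 else 0) + count (p ∘ Fin.suc)

count-cong : ∀ {n} {p q : Fin n → Bool} → (∀ k → p k ≡ q k) → count p ≡ count q
count-cong {zero}  eq = refl
count-cong {suc n} eq = cong₂ (λ b m → (if b then 1 else 0) + m) (eq Fin.zero) (count-cong (eq ∘ Fin.suc))

T↔Fin : ∀ b → T b ↔ Fin (if b then 1 else 0)
T↔Fin true  = ↔-sym 1↔⊤
T↔Fin false = ↔-sym 0↔⊥

Σ-Fin-suc↔ : ∀ {n} (P : Fin (suc n) → Set) → Σ (Fin (suc n)) P ↔ (P Fin.zero ⊎ Σ (Fin n) (P ∘ Fin.suc))
Σ-Fin-suc↔ P = mk↔ₛ′ to from
  (λ { (inj₁ _) → refl ; (inj₂ _) → refl })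
  (λ { (Fin.zero , _) → refl ; (Fin.suc _ , _) → refl })
  where
  to : Σ _ P → P Fin.zero ⊎ Σ _ (P ∘ Fin.suc)
  to (Fin.zero , p)  = inj₁ p
  to (Fin.suc k , p) = inj₂ (k , p)
  from : P Fin.zero ⊎ Σ _ (P ∘ Fin.suc) → Σ _ P
  from (inj₁ p)       = Fin.zero , p
  from (inj₂ (k , p)) = Fin.suc k , p

Σ-T↔Fin-count : ∀ {n} (p : Fin n → Bool) → Σ (Fin n) (T ∘ p) ↔ Fin (count p)
Σ-T↔Fin-count {zero}  p = mk↔ₛ′ (λ ()) (λ ()) (λ ()) (λ ())
Σ-T↔Fin-count {suc n} p =
  ↔-trans (Σ-Fin-suc↔ (T ∘ p))
    (↔-trans (T↔Fin (p Fin.zero) ⊎-↔ Σ-T↔Fin-count (p ∘ Fin.suc)) (↔-sym +↔⊎))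

Σ-T-reindex : ∀ {A I : Set} {p : A → Bool} (f : I → A) → Injective _≡_ _≡_ f →
              (∀ x → T (p x) → ∃[ i ] f i ≡ x) → Σ A (T ∘ p) ↔ Σ I (T ∘ p ∘ f)
Σ-T-reindex {p = p} f f-injective cover = mk↔ₛ′ to from to-from from-to
  where
  to : Σ _ (T ∘ p) → Σ _ (T ∘ p ∘ f)
  to (x , t) = proj₁ (cover x t) , subst (T ∘ p) (sym (proj₂ (cover x t))) t
  from : Σ _ (T ∘ p ∘ f) → Σ _ (T ∘ p)
  from (i , t) = f i , t
  to-from : ∀ y → to (from y) ≡ y
  to-from (i , t) = Σ-≡,≡→≡ (f-injective (proj₂ (cover (f i) t)) , T-irrelevant _ _)
  from-to : ∀ y → from (to y) ≡ y
  from-to (x , t) = Σ-≡,≡→≡ (proj₂ (cover x t) , T-irrelevant _ _)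

⌊⌋-cong : ∀ {A B : Set} {a? : Dec A} {b? : Dec B} → A ⇔ B → ⌊ a? ⌋ ≡ ⌊ b? ⌋
⌊⌋-cong {a? = yes _} {yes _} _   = refl
⌊⌋-cong {a? = no _}  {no _}  _   = refl
⌊⌋-cong {a? = yes a} {no ¬b} A⇔B = contradiction (Equivalence.to A⇔B a) ¬b
⌊⌋-cong {a? = no ¬a} {yes b} A⇔B = contradiction (Equivalence.from A⇔B b) ¬a

⌊⌋-∧ : ∀ {A B : Set} (a? : Dec A) (b? : Dec B) → ⌊ a? ⌋ ∧ ⌊ b? ⌋ ≡ ⌊ a? ×-dec b? ⌋
⌊⌋-∧ (yes _) (yes _) = refl
⌊⌋-∧ (yes _) (no _)  = refl
⌊⌋-∧ (no _)  _       = refl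

exactly-one : ∀ {A B : Set} (a? : Dec A) (b? : Dec B) → (A → ¬ B) → (¬ A → B) → ∀ n →
              (if ⌊ a? ⌋ then 1 else 0) + ((if ⌊ b? ⌋ then 1 else 0) + n) ≡ suc n
exactly-one (yes _) (no _)  _     _     n = refl
exactly-one (no _)  (yes _) _     _     n = refl
exactly-one (yes a) (yes b) A⇒¬B  _     n = contradiction b (A⇒¬B a)
exactly-one (no ¬a) (no ¬b) _     ¬A⇒B n = contradiction (¬A⇒B ¬a) ¬b

neither : ∀ {A B : Set} (a? : Dec A) (b? : Dec B) → ¬ A → ¬ B → ∀ n →
          (if ⌊ a? ⌋ then 1 else 0) + ((if ⌊ b? ⌋ then 1 else 0) + n) ≡ n
neither (no _)  (no _)  _  _  n = refl
neither (yes a) _       ¬a _  n = contradiction a ¬a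
neither (no _)  (yes b) _  ¬b n = contradiction b ¬b

distinct-comparable : ∀ {i j} → i ≢ j → ∀ b b′ → (⌊ i <? j ⌋ ∨ b) ∨ (⌊ j <? i ⌋ ∨ b′) ≡ true
distinct-comparable {i} {j} i≢j b b′ with i <? j | j <? i
... | yes _   | _       = refl
... | no _    | yes _   = ∨-zeroʳ b
... | no i≮j  | no j≮i  = contradiction (≤-antisym (≮⇒≥ j≮i) (≮⇒≥ i≮j)) i≢j

-- Sums modulo N in {1,…,N}

-- i is j + t reduced into {1,…,N}: i ≡ j + t (mod N) with i ∈ {1,…,N} when j ∈ {1,…,N}, t ≤ N.
data CyclicSum (N j t : ℕ) : ℕ → Set where
  no-wrap : j + t ≤ N → CyclicSum N j t (j + t)
  wrap    : ∀ {i} → N < j + t → i + N ≡ j + t → CyclicSum N j t i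

wrapped-≤ : ∀ {N j t i} → j ≤ N → i + N ≡ j + t → i ≤ t
wrapped-≤ {N} {j} {t} {i} j≤N eq = +-cancelʳ-≤ N i t (begin
  i + N  ≡⟨ eq ⟩
  j + t  ≤⟨ +-monoˡ-≤ t j≤N ⟩
  N + t  ≡⟨ +-comm N t ⟩
  t + N  ∎)
  where open ≤-Reasoning

cyclicSum-≢ : ∀ {N j t i} → 0 < t → t < N → CyclicSum N j t i → j ≢ i
cyclicSum-≢ {j = j} 0<t _   (no-wrap _) = <⇒≢ (m<m+n j 0<t)
cyclicSum-≢ {N} {j} {t} _ t<N (wrap _ eq) refl = <⇒≢ t<N (sym (+-cancelˡ-≡ j N t eq))

cyclicSum-+-≤ : ∀ {N j t i} u → 1 ≤ j → j ≤ N → CyclicSum N j t i → (j + t + u ≤ N ⇔ (t < i × i + u ≤ N))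
cyclicSum-+-≤ {t = t} u 1≤j _ (no-wrap _) = mk⇔ (λ le → m<n+m t 1≤j , le) proj₂
cyclicSum-+-≤ {j = j} {t} u _ j≤N (wrap N<j+t eq) = mk⇔
  (λ le → contradiction (≤-trans (m≤m+n (j + t) u) le) (<⇒≱ N<j+t))
  (λ (t<i , _) → contradiction (wrapped-≤ j≤N eq) (<⇒≱ t<i))

wrapped-+ : ∀ N j k r s → j + N ≡ k + s → k + r + s ≡ j + r + N
wrapped-+ N j k r s eq = trans (xy∙z≈xz∙y k r s) (trans (cong (_+ r) (sym eq)) (xy∙z≈xz∙y j N r))

cyclicSum-southwest : ∀ {N r s k j i} → 1 ≤ r → s ≤ N → 1 ≤ j → j ≤ N →
  CyclicSum N k s j → CyclicSum N j r i → (k + r ≤ N × N < k + s) ⇔ (r < i × i ≤ s)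
cyclicSum-southwest {r = r} {s} {k} 1≤r _ _ _ (no-wrap k+s≤N) (no-wrap _) = mk⇔
  (λ (_ , N<k+s) → contradiction k+s≤N (<⇒≱ N<k+s))
  (λ (_ , i≤s) → contradiction i≤s (<⇒≱ (<-≤-trans (m<m+n s 1≤r) (+-monoˡ-≤ r (m≤n+m s k)))))
cyclicSum-southwest _ _ _ j≤N (no-wrap k+s≤N) (wrap _ eq) = mk⇔
  (λ (_ , N<k+s) → contradiction k+s≤N (<⇒≱ N<k+s))
  (λ (r<i , _) → contradiction (wrapped-≤ j≤N eq) (<⇒≱ r<i))
cyclicSum-southwest {N} {r} {s} {k} {j} _ _ 1≤j _ (wrap N<k+s eq) (no-wrap _) = mk⇔
  (λ (k+r≤N , _) → m<n+m r 1≤j , +-cancelʳ-≤ N (j + r) s (begin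
     j + r + N  ≡⟨ key ⟨
     k + r + s  ≤⟨ +-monoˡ-≤ s k+r≤N ⟩
     N + s      ≡⟨ +-comm N s ⟩
     s + N      ∎))
  (λ (_ , j+r≤s) → +-cancelʳ-≤ s (k + r) N (begin
     k + r + s  ≡⟨ key ⟩
     j + r + N  ≤⟨ +-monoˡ-≤ N j+r≤s ⟩
     s + N      ≡⟨ +-comm s N ⟩
     N + s      ∎) , N<k+s)
  where
  open ≤-Reasoning
  key : k + r + s ≡ j + r + N
  key = wrapped-+ N j k r s eq
cyclicSum-southwest {N} {r} {s} {k} {j} _ s≤N _ j≤N (wrap N<k+s eq₁) (wrap N<j+r eq₂) = mk⇔
  (λ (k+r≤N , _) → contradiction (+-monoˡ-≤ s k+r≤N) (<⇒≱ (begin-strict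
     N + s      ≤⟨ +-monoʳ-≤ N s≤N ⟩
     N + N      <⟨ +-monoˡ-< N N<j+r ⟩
     j + r + N  ≡⟨ key ⟨
     k + r + s  ∎)))
  (λ (r<i , _) → contradiction (wrapped-≤ j≤N eq₂) (<⇒≱ r<i))
  where
  open ≤-Reasoning
  key : k + r + s ≡ j + r + N
  key = wrapped-+ N j k r s eq₁

-- Residues modulo N

module _ (N : ℕ) .{{_ : NonZero N}} where

  remainder-unique : ∀ {m m'} d → + m ≡ + m' ℤ.+ d ℤ.* + N → m < N → m' < N → m ≡ m'
  remainder-unique {m} {m'} (+ n) eq m<N _ =
    multiple-zero n (ℤP.+-injective (trans eq (cong (λ z → + m' ℤ.+ z) (sym (ℤP.pos-* n N)))))
    where
    multiple-zero : ∀ n → m ≡ m' + n * N → m ≡ m'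
    multiple-zero zero    m≡m' = trans m≡m' (+-identityʳ m')
    multiple-zero (suc n) m≡m'+N+nN =
      contradiction (subst (N ≤_) (sym m≡m'+N+nN) (≤-trans (m≤m+n N (n * N)) (m≤n+m _ m'))) (<⇒≱ m<N)
  remainder-unique {m} {m'} d@(-[1+ n ]) eq m<N m'<N =
    sym (remainder-unique +[1+ n ] (trans (cancel (+ m') d (+ N)) (cong (ℤ._+ ℤ.- d ℤ.* + N) (sym eq))) m'<N m<N)
    where
    cancel : ∀ x d n → x ≡ (x ℤ.+ d ℤ.* n) ℤ.+ ℤ.- d ℤ.* n
    cancel = solve-∀

  %ℕ-unique : ∀ u {m} q → u ≡ + m ℤ.+ q ℤ.* + N → m < N → u %ℕ N ≡ m
  %ℕ-unique u {m} q u≡m+qN m<N = sym (remainder-unique (u /ℕ N ℤ.- q) (begin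
    + m                                          ≡⟨ add-sub (+ m) (q ℤ.* + N) ⟩
    + m ℤ.+ q ℤ.* + N ℤ.- q ℤ.* + N              ≡⟨ cong (ℤ._- q ℤ.* + N) (trans (sym u≡m+qN) (a≡a%ℕn+[a/ℕn]*n u N)) ⟩
    + (u %ℕ N) ℤ.+ (u /ℕ N) ℤ.* + N ℤ.- q ℤ.* + N ≡⟨ regroup (+ (u %ℕ N)) (u /ℕ N) q (+ N) ⟩
    + (u %ℕ N) ℤ.+ (u /ℕ N ℤ.- q) ℤ.* + N        ∎) m<N (n%ℕd<d u N))
    where
    open ≡-Reasoning
    add-sub : ∀ x y → x ≡ x ℤ.+ y ℤ.- y
    add-sub = solve-∀
    regroup : ∀ x Q q n → x ℤ.+ Q ℤ.* n ℤ.- q ℤ.* n ≡ x ℤ.+ (Q ℤ.- q) ℤ.* n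
    regroup = solve-∀

  res1≤N : ∀ u → res1 N u ≤ N
  res1≤N u = n%ℕd<d (u ℤ.- 1ℤ) N

  res1-+ : ∀ u {k} → k ≤ N → CyclicSum N (res1 N u) k (res1 N (u ℤ.+ + k))
  res1-+ u {k} k≤N = by-cases (m + k <? N)
    where
    m : ℕ
    m = (u ℤ.- 1ℤ) %ℕ N
    q : ℤ
    q = (u ℤ.- 1ℤ) /ℕ N
    shifted : u ℤ.+ + k ℤ.- 1ℤ ≡ + (m + k) ℤ.+ q ℤ.* + N
    shifted = begin
      u ℤ.+ + k ℤ.- 1ℤ                ≡⟨ swap u (+ k) ⟩
      (u ℤ.- 1ℤ) ℤ.+ + k              ≡⟨ cong (ℤ._+ + k) (a≡a%ℕn+[a/ℕn]*n (u ℤ.- 1ℤ) N) ⟩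
      + m ℤ.+ q ℤ.* + N ℤ.+ + k        ≡⟨ swap-last (+ m) (q ℤ.* + N) (+ k) ⟩
      + m ℤ.+ + k ℤ.+ q ℤ.* + N        ≡⟨ cong (ℤ._+ q ℤ.* + N) (ℤP.pos-+ m k) ⟨
      + (m + k) ℤ.+ q ℤ.* + N          ∎
      where
      open ≡-Reasoning
      swap : ∀ u k → u ℤ.+ k ℤ.- 1ℤ ≡ (u ℤ.- 1ℤ) ℤ.+ k
      swap = solve-∀
      swap-last : ∀ x y z → x ℤ.+ y ℤ.+ z ≡ x ℤ.+ z ℤ.+ y
      swap-last = solve-∀
    by-cases : Dec (m + k < N) → CyclicSum N (suc m) k (res1 N (u ℤ.+ + k))
    by-cases (yes m+k<N) =
      subst (CyclicSum N (suc m) k) (cong suc (sym (%ℕ-unique _ q shifted m+k<N))) (no-wrap m+k<N)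
    by-cases (no m+k≮N) = wrap (s≤s N≤m+k) (cong suc (begin
      (u ℤ.+ + k ℤ.- 1ℤ) %ℕ N + N ≡⟨ cong (_+ N) (%ℕ-unique _ (q ℤ.+ 1ℤ) shifted′ m+k∸N<N) ⟩
      m + k ∸ N + N              ≡⟨ m∸n+n≡m N≤m+k ⟩
      m + k                      ∎))
      where
      open ≡-Reasoning
      N≤m+k : N ≤ m + k
      N≤m+k = ≮⇒≥ m+k≮N
      m+k∸N<N : m + k ∸ N < N
      m+k∸N<N = m<n+o⇒m∸n<o (m + k) N (+-mono-<-≤ (n%ℕd<d (u ℤ.- 1ℤ) N) k≤N)
      carry : ∀ x n q → x ℤ.+ n ℤ.+ q ℤ.* n ≡ x ℤ.+ (q ℤ.+ 1ℤ) ℤ.* n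
      carry = solve-∀
      shifted′ : u ℤ.+ + k ℤ.- 1ℤ ≡ + (m + k ∸ N) ℤ.+ (q ℤ.+ 1ℤ) ℤ.* + N
      shifted′ = begin
        u ℤ.+ + k ℤ.- 1ℤ                    ≡⟨ shifted ⟩
        + (m + k) ℤ.+ q ℤ.* + N              ≡⟨ cong (λ z → + z ℤ.+ q ℤ.* + N) (m∸n+n≡m N≤m+k) ⟨
        + (m + k ∸ N + N) ℤ.+ q ℤ.* + N      ≡⟨ cong (ℤ._+ q ℤ.* + N) (ℤP.pos-+ (m + k ∸ N) N) ⟩
        + (m + k ∸ N) ℤ.+ + N ℤ.+ q ℤ.* + N  ≡⟨ carry (+ (m + k ∸ N)) (+ N) q ⟩
        + (m + k ∸ N) ℤ.+ (q ℤ.+ 1ℤ) ℤ.* + N ∎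

-- The sides of a face as a function of its label

Direction : Set
Direction = Fin 8

pattern east      = Fin.zero
pattern north     = Fin.suc Fin.zero
pattern west      = Fin.suc (Fin.suc Fin.zero)
pattern south     = Fin.suc (Fin.suc (Fin.suc Fin.zero))
pattern northeast = Fin.suc (Fin.suc (Fin.suc (Fin.suc Fin.zero)))
pattern northwest = Fin.suc (Fin.suc (Fin.suc (Fin.suc (Fin.suc Fin.zero))))
pattern southwest = Fin.suc (Fin.suc (Fin.suc (Fin.suc (Fin.suc (Fin.suc Fin.zero)))))
pattern southeast = Fin.suc (Fin.suc (Fin.suc (Fin.suc (Fin.suc (Fin.suc (Fin.suc Fin.zero))))))

module _ (N r s : ℕ) where

  HasSide : ℕ → Direction → Set
  HasSide i northeast = i + r ≤ N × N < i + s
  HasSide i northwest = r < i × i + s ≤ N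
  HasSide i southwest = r < i × i ≤ s
  HasSide i southeast = s < i × i + r ≤ N
  HasSide i _         = ⊤

  hasSide? : ∀ i k → Dec (HasSide i k)
  hasSide? i east      = yes tt
  hasSide? i north     = yes tt
  hasSide? i west      = yes tt
  hasSide? i south     = yes tt
  hasSide? i northeast = (i + r ≤? N) ×-dec (N <? i + s)
  hasSide? i northwest = (r <? i) ×-dec (i + s ≤? N)
  hasSide? i southwest = (r <? i) ×-dec (i ≤? s)
  hasSide? i southeast = (s <? i) ×-dec (i + r ≤? N)

  sides : ℕ → Direction → Bool
  sides i k = ⌊ hasSide? i k ⌋

  Inner Corner : ℕ → Set
  Inner i  = r < i × i + r ≤ N
  Corner i = i ≤ r ⊎ N ∸ r < i

  corner⇒¬inner : ∀ {i} → Corner i → ¬ Inner i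
  corner⇒¬inner (inj₁ i≤r)   (r<i , _)     = <⇒≱ r<i i≤r
  corner⇒¬inner (inj₂ N∸r<i) (_ , i+r≤N) = <⇒≱ N∸r<i (m+n≤o⇒m≤o∸n _ i+r≤N)

  ¬corner⇒inner : ∀ {i} → r ≤ N → ¬ Corner i → Inner i
  ¬corner⇒inner {i} r≤N ¬corner = ≰⇒> (¬corner ∘ inj₁) , m≤o∸n⇒m+n≤o i r≤N (≮⇒≥ (¬corner ∘ inj₂))

  module _ (r<s : r < s) (s+s≤N : s + s ≤ N) where

    -- The axis directions come first, so count (sides i) unfolds to 4 + [NE] + [NW] + [SW] + [SE].
    sides-square : ∀ {i} → Corner i → count (sides i) ≡ 4
    sides-square {i} corner = cong (λ n → 4 + n) (trans
      (neither (hasSide? i northeast) (hasSide? i northwest)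
        (¬inner ∘ northeast-inner) (¬inner ∘ northwest-inner) _)
      (neither (hasSide? i southwest) (hasSide? i southeast)
        (¬inner ∘ southwest-inner) (¬inner ∘ southeast-inner) 0))
      where
      ¬inner : ¬ Inner i
      ¬inner = corner⇒¬inner corner
      northeast-inner : HasSide i northeast → Inner i
      northeast-inner (i+r≤N , N<i+s) = <-trans r<s (+-cancelʳ-< s s i (≤-<-trans s+s≤N N<i+s)) , i+r≤N
      northwest-inner : HasSide i northwest → Inner i
      northwest-inner (r<i , i+s≤N) = r<i , ≤-trans (+-monoʳ-≤ i (<⇒≤ r<s)) i+s≤N
      southwest-inner : HasSide i southwest → Inner i
      southwest-inner (r<i , i≤s) = r<i , ≤-trans (+-mono-≤ i≤s (<⇒≤ r<s)) s+s≤N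
      southeast-inner : HasSide i southeast → Inner i
      southeast-inner (s<i , i+r≤N) = <-trans r<s s<i , i+r≤N

    sides-hexagon : ∀ {i} → ¬ Corner i → count (sides i) ≡ 6
    sides-hexagon {i} ¬corner with ¬corner⇒inner (≤-trans (<⇒≤ r<s) (≤-trans (m≤m+n s s) s+s≤N)) ¬corner
    ... | r<i , i+r≤N = cong (λ n → 4 + n) (trans
      (exactly-one (hasSide? i northeast) (hasSide? i northwest)
        (λ (_ , N<i+s) (_ , i+s≤N) → <⇒≱ N<i+s i+s≤N)
        (λ ¬ne → r<i , ≮⇒≥ (¬ne ∘ (i+r≤N ,_))) _)
      (cong suc (exactly-one (hasSide? i southwest) (hasSide? i southeast)
        (λ (_ , i≤s) (s<i , _) → <⇒≱ s<i i≤s)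
        (λ ¬sw → ≰⇒> (¬sw ∘ (r<i ,_)) , i+r≤N) 0)))

-- The neighbourhood of a vertex of Q̃

_+ᵥ_ : Vertex → ℤ × ℤ → Vertex
(a , b) +ᵥ (x , y) = a ℤ.+ x , b ℤ.+ y

_-ᵥ_ : Vertex → Vertex → ℤ × ℤ
(c , d) -ᵥ (a , b) = c ℤ.- a , d ℤ.- b

+ᵥ-cancelˡ : ∀ v {δ δ′} → v +ᵥ δ ≡ v +ᵥ δ′ → δ ≡ δ′
+ᵥ-cancelˡ (a , b) eq = cong₂ _,_ (∙-cancelˡ a _ _ (cong proj₁ eq)) (∙-cancelˡ b _ _ (cong proj₂ eq))

v+ᵥ[w-ᵥv]≡w : ∀ v w → v +ᵥ (w -ᵥ v) ≡ w
v+ᵥ[w-ᵥv]≡w (a , b) (c , d) = cong₂ _,_ (add-sub a c) (add-sub b d)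
  where
  add-sub : ∀ a c → a ℤ.+ (c ℤ.- a) ≡ c
  add-sub = solve-∀

pred-suc : ∀ a → a ≡ a ℤ.+ -1ℤ ℤ.+ 1ℤ
pred-suc = solve-∀

offset : Direction → ℤ × ℤ
offset east      = 1ℤ  , 0ℤ
offset north     = 0ℤ  , 1ℤ
offset west      = -1ℤ , 0ℤ
offset south     = 0ℤ  , -1ℤ
offset northeast = 1ℤ  , 1ℤ
offset northwest = -1ℤ , 1ℤ
offset southwest = -1ℤ , -1ℤ
offset southeast = 1ℤ  , -1ℤ

direction : ℤ × ℤ → Direction
direction (+ 1     , + 0)     = east
direction (+ 0     , + 1)     = north
direction (-[1+ 0 ] , + 0)     = west
direction (+ 0     , -[1+ 0 ]) = south
direction (+ 1     , + 1)     = northeast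
direction (-[1+ 0 ] , + 1)     = northwest
direction (-[1+ 0 ] , -[1+ 0 ]) = southwest
direction _                   = southeast

direction-offset : ∀ k → direction (offset k) ≡ k
direction-offset east      = refl
direction-offset north     = refl
direction-offset west      = refl
direction-offset south     = refl
direction-offset northeast = refl
direction-offset northwest = refl
direction-offset southwest = refl
direction-offset southeast = refl

neighbour : Vertex → Direction → Vertex
neighbour v k = v +ᵥ offset k

neighbour-injective : ∀ v → Injective _≡_ _≡_ (neighbour v)
neighbour-injective v {k} {k′} eq = begin
  k                       ≡⟨ direction-offset k ⟨
  direction (offset k)    ≡⟨ cong direction (+ᵥ-cancelˡ v eq) ⟩
  direction (offset k′)   ≡⟨ direction-offset k′ ⟩
  k′                      ∎
  where open ≡-Reasoning

==-translate : ∀ {u u′ a x y} → u ≡ a ℤ.+ x → u′ ≡ a ℤ.+ y → (u == u′) ≡ (x == y)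
==-translate {a = a} u≡a+x u′≡a+y = ⌊⌋-cong (mk⇔
  (λ u≡u′ → ∙-cancelˡ a _ _ (trans (sym u≡a+x) (trans u≡u′ u′≡a+y)))
  (λ x≡y → trans u≡a+x (trans (cong (λ z → a ℤ.+ z) x≡y) (sym u′≡a+y))))

module _ (N r s : ℕ) .{{_ : NonZero N}} where

  private
    L : Vertex → ℕ
    L = lab N r s

  adjacent : Vertex → Vertex → Bool
  adjacent v w = arrow N r s v w ∨ arrow N r s w v

  -- arrow v (v +ᵥ δ) and arrow (v +ᵥ δ) v with every coordinate test rewritten as a
  -- test on δ alone, so that both compute when δ is a literal offset.
  arrowTo arrowFrom : Vertex → ℤ × ℤ → Bool
  arrowTo (a , b) (x , y) =
    ((0ℤ == y) ∧ ((x == 1ℤ) ∨ (0ℤ == (x ℤ.+ 1ℤ))) ∧ ⌊ L (a , b) <? L (a ℤ.+ x , b ℤ.+ y) ⌋)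
    ∨ ((0ℤ == x) ∧ ((y == 1ℤ) ∨ (0ℤ == (y ℤ.+ 1ℤ))) ∧ ⌊ L (a ℤ.+ x , b ℤ.+ y) <? L (a , b) ⌋)
    ∨ ((0ℤ == (x ℤ.+ 1ℤ)) ∧ (y == 1ℤ) ∧ diag₁ N r s (a ℤ.+ x , b))
    ∨ ((0ℤ == (x ℤ.+ 1ℤ)) ∧ (0ℤ == (y ℤ.+ 1ℤ)) ∧ diag₂ N r s (a ℤ.+ x , b ℤ.+ y))
  arrowFrom (a , b) (x , y) =
    ((y == 0ℤ) ∧ ((0ℤ == (x ℤ.+ 1ℤ)) ∨ (x == 1ℤ)) ∧ ⌊ L (a ℤ.+ x , b ℤ.+ y) <? L (a , b) ⌋)
    ∨ ((x == 0ℤ) ∧ ((0ℤ == (y ℤ.+ 1ℤ)) ∨ (y == 1ℤ)) ∧ ⌊ L (a , b) <? L (a ℤ.+ x , b ℤ.+ y) ⌋)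
    ∨ ((x == 1ℤ) ∧ (0ℤ == (y ℤ.+ 1ℤ)) ∧ diag₁ N r s (a , b ℤ.+ y))
    ∨ ((x == 1ℤ) ∧ (y == 1ℤ) ∧ diag₂ N r s (a , b))

  adjacent-+ᵥ : ∀ v δ → adjacent v (v +ᵥ δ) ≡ arrowTo v δ ∨ arrowFrom v δ
  adjacent-+ᵥ (a , b) (x , y) = cong₂ _∨_ arrow-to arrow-from
    where
    a≡a+0 : a ≡ a ℤ.+ 0ℤ
    a≡a+0 = sym (ℤP.+-identityʳ a)
    b≡b+0 : b ≡ b ℤ.+ 0ℤ
    b≡b+0 = sym (ℤP.+-identityʳ b)
    arrow-to : arrow N r s (a , b) (a ℤ.+ x , b ℤ.+ y) ≡ arrowTo (a , b) (x , y)
    arrow-to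
      rewrite ==-translate {b} {b ℤ.+ y} {b} {0ℤ} {y} b≡b+0 refl
            | ==-translate {a ℤ.+ x} {a ℤ.+ 1ℤ} {a} {x} {1ℤ} refl refl
            | ==-translate {a} {a ℤ.+ x ℤ.+ 1ℤ} {a} {0ℤ} {x ℤ.+ 1ℤ} a≡a+0 (ℤP.+-assoc a x 1ℤ)
            | ==-translate {a} {a ℤ.+ x} {a} {0ℤ} {x} a≡a+0 refl
            | ==-translate {b ℤ.+ y} {b ℤ.+ 1ℤ} {b} {y} {1ℤ} refl refl
            | ==-translate {b} {b ℤ.+ y ℤ.+ 1ℤ} {b} {0ℤ} {y ℤ.+ 1ℤ} b≡b+0 (ℤP.+-assoc b y 1ℤ)
            = refl
    arrow-from : arrow N r s (a ℤ.+ x , b ℤ.+ y) (a , b) ≡ arrowFrom (a , b) (x , y)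
    arrow-from
      rewrite ==-translate {b ℤ.+ y} {b} {b} {y} {0ℤ} refl b≡b+0
            | ==-translate {a ℤ.+ x} {a ℤ.+ 1ℤ} {a} {x} {1ℤ} refl refl
            | ==-translate {a} {a ℤ.+ x ℤ.+ 1ℤ} {a} {0ℤ} {x ℤ.+ 1ℤ} a≡a+0 (ℤP.+-assoc a x 1ℤ)
            | ==-translate {a ℤ.+ x} {a} {a} {x} {0ℤ} refl a≡a+0
            | ==-translate {b ℤ.+ y} {b ℤ.+ 1ℤ} {b} {y} {1ℤ} refl refl
            | ==-translate {b} {b ℤ.+ y ℤ.+ 1ℤ} {b} {0ℤ} {y ℤ.+ 1ℤ} b≡b+0 (ℤP.+-assoc b y 1ℤ)
            = refl

  offset-of-arrow : ∀ v δ → T (arrowTo v δ ∨ arrowFrom v δ) → ∃[ k ] offset k ≡ δ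
  offset-of-arrow v (+ 0              , + 0)              ()
  offset-of-arrow v (+ 0              , + 1)              _ = north , refl
  offset-of-arrow v (+ 0              , + suc (suc _))    ()
  offset-of-arrow v (+ 0              , -[1+ 0 ])         _ = south , refl
  offset-of-arrow v (+ 0              , -[1+ suc _ ])     ()
  offset-of-arrow v (+ 1              , + 0)              _ = east , refl
  offset-of-arrow v (+ 1              , + 1)              _ = northeast , refl
  offset-of-arrow v (+ 1              , + suc (suc _))    ()
  offset-of-arrow v (+ 1              , -[1+ 0 ])         _ = southeast , refl
  offset-of-arrow v (+ 1              , -[1+ suc _ ])     ()
  offset-of-arrow v (+ suc (suc _)    , + 0)              ()
  offset-of-arrow v (+ suc (suc _)    , + 1)              ()
  offset-of-arrow v (+ suc (suc _)    , + suc (suc _))    ()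
  offset-of-arrow v (+ suc (suc _)    , -[1+ 0 ])         ()
  offset-of-arrow v (+ suc (suc _)    , -[1+ suc _ ])     ()
  offset-of-arrow v (-[1+ 0 ]         , + 0)              _ = west , refl
  offset-of-arrow v (-[1+ 0 ]         , + 1)              _ = northwest , refl
  offset-of-arrow v (-[1+ 0 ]         , + suc (suc _))    ()
  offset-of-arrow v (-[1+ 0 ]         , -[1+ 0 ])         _ = southwest , refl
  offset-of-arrow v (-[1+ 0 ]         , -[1+ suc _ ])     ()
  offset-of-arrow v (-[1+ suc _ ]     , + 0)              ()
  offset-of-arrow v (-[1+ suc _ ]     , + 1)              ()
  offset-of-arrow v (-[1+ suc _ ]     , + suc (suc _))    ()
  offset-of-arrow v (-[1+ suc _ ]     , -[1+ 0 ])         ()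
  offset-of-arrow v (-[1+ suc _ ]     , -[1+ suc _ ])     ()

  adjacent⇒neighbour : ∀ v w → T (adjacent v w) → ∃[ k ] neighbour v k ≡ w
  adjacent⇒neighbour v w v~w with offset-of-arrow v (w -ᵥ v) v~v+[w-v]
    where
    v~v+[w-v] : T (arrowTo v (w -ᵥ v) ∨ arrowFrom v (w -ᵥ v))
    v~v+[w-v] = subst T (adjacent-+ᵥ v (w -ᵥ v)) (subst (T ∘ adjacent v) (sym (v+ᵥ[w-ᵥv]≡w v w)) v~w)
  ... | k , offset-k≡w-v = k , trans (cong (v +ᵥ_) offset-k≡w-v) (v+ᵥ[w-ᵥv]≡w v w)

  FaceSides↔Fin-count : ∀ v → FaceSides N r s v ↔ Fin (count (adjacent v ∘ neighbour v))
  FaceSides↔Fin-count v =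
    ↔-trans (Σ-T-reindex (neighbour v) (neighbour-injective v) (adjacent⇒neighbour v))
            (Σ-T↔Fin-count (adjacent v ∘ neighbour v))

  lab-east : ∀ a b {a′ b′} → r ≤ N → a′ ≡ a ℤ.+ 1ℤ → b′ ≡ b → CyclicSum N (L (a , b)) r (L (a′ , b′))
  lab-east a b r≤N refl refl =
    subst (CyclicSum N (L (a , b)) r) (cong (res1 N) (sym (step a b (+ r) (+ s))))
      (res1-+ N (1ℤ ℤ.+ a ℤ.* + r ℤ.+ b ℤ.* + s) r≤N)
    where
    step : ∀ a b r s → 1ℤ ℤ.+ (a ℤ.+ 1ℤ) ℤ.* r ℤ.+ b ℤ.* s ≡ 1ℤ ℤ.+ a ℤ.* r ℤ.+ b ℤ.* s ℤ.+ r
    step = solve-∀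

  lab-north : ∀ a b {a′ b′} → s ≤ N → a′ ≡ a → b′ ≡ b ℤ.+ 1ℤ → CyclicSum N (L (a , b)) s (L (a′ , b′))
  lab-north a b s≤N refl refl =
    subst (CyclicSum N (L (a , b)) s) (cong (res1 N) (sym (step a b (+ r) (+ s))))
      (res1-+ N (1ℤ ℤ.+ a ℤ.* + r ℤ.+ b ℤ.* + s) s≤N)
    where
    step : ∀ a b r s → 1ℤ ℤ.+ a ℤ.* r ℤ.+ (b ℤ.+ 1ℤ) ℤ.* s ≡ 1ℤ ℤ.+ a ℤ.* r ℤ.+ b ℤ.* s ℤ.+ s
    step = solve-∀

  lab≤N : ∀ v → L v ≤ N
  lab≤N (a , b) = res1≤N N (1ℤ ℤ.+ a ℤ.* + r ℤ.+ b ℤ.* + s)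

  module _ (1≤r : 1 ≤ r) (r<s : r < s) (s<N : s < N) where

    private
      r<N : r < N
      r<N = <-trans r<s s<N
      r≤N : r ≤ N
      r≤N = <⇒≤ r<N
      s≤N : s ≤ N
      s≤N = <⇒≤ s<N
      0<s : 0 < s
      0<s = <-trans 1≤r r<s

    arrows-offset : ∀ v k → arrowTo v (offset k) ∨ arrowFrom v (offset k) ≡ sides N r s (L v) k
    arrows-offset (a , b) east = distinct-comparable (cyclicSum-≢ 1≤r r<N east′) false false
      where
      east′ : CyclicSum N (L (a , b)) r (L (a ℤ.+ 1ℤ , b ℤ.+ 0ℤ))
      east′ = lab-east a b r≤N refl (ℤP.+-identityʳ b)
    arrows-offset (a , b) north = distinct-comparable (≢-sym (cyclicSum-≢ 0<s s<N north′)) false false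
      where
      north′ : CyclicSum N (L (a , b)) s (L (a ℤ.+ 0ℤ , b ℤ.+ 1ℤ))
      north′ = lab-north a b s≤N (ℤP.+-identityʳ a) refl
    arrows-offset (a , b) west = distinct-comparable (≢-sym (cyclicSum-≢ 1≤r r<N west′)) false false
      where
      west′ : CyclicSum N (L (a ℤ.+ -1ℤ , b ℤ.+ 0ℤ)) r (L (a , b))
      west′ = lab-east (a ℤ.+ -1ℤ) (b ℤ.+ 0ℤ) r≤N (pred-suc a) (sym (ℤP.+-identityʳ b))
    arrows-offset (a , b) south = distinct-comparable (cyclicSum-≢ 0<s s<N south′) false false
      where
      south′ : CyclicSum N (L (a ℤ.+ 0ℤ , b ℤ.+ -1ℤ)) s (L (a , b))
      south′ = lab-north (a ℤ.+ 0ℤ) (b ℤ.+ -1ℤ) s≤N (sym (ℤP.+-identityʳ a)) (pred-suc b)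
    arrows-offset (a , b) northeast = ⌊⌋-∧ (L (a , b) + r ≤? N) (N <? L (a , b) + s)
    arrows-offset (a , b) northwest = trans (trans (∨-identityʳ _) (∨-identityʳ _))
      (⌊⌋-cong (cyclicSum-+-≤ s (s≤s z≤n) (lab≤N (a ℤ.+ -1ℤ , b)) west′))
      where
      west′ : CyclicSum N (L (a ℤ.+ -1ℤ , b)) r (L (a , b))
      west′ = lab-east (a ℤ.+ -1ℤ) b r≤N (pred-suc a) refl
    arrows-offset (a , b) southwest = trans (∨-identityʳ _) (trans (⌊⌋-∧ (sw + r ≤? N) (N <? sw + s))
      (⌊⌋-cong (cyclicSum-southwest 1≤r s≤N (s≤s z≤n) (lab≤N (a ℤ.+ -1ℤ , b)) southwest′ west′)))
      where
      sw : ℕ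
      sw = L (a ℤ.+ -1ℤ , b ℤ.+ -1ℤ)
      west′ : CyclicSum N (L (a ℤ.+ -1ℤ , b)) r (L (a , b))
      west′ = lab-east (a ℤ.+ -1ℤ) b r≤N (pred-suc a) refl
      southwest′ : CyclicSum N sw s (L (a ℤ.+ -1ℤ , b))
      southwest′ = lab-north (a ℤ.+ -1ℤ) (b ℤ.+ -1ℤ) s≤N refl (pred-suc b)
    arrows-offset (a , b) southeast = trans (∨-identityʳ _)
      (⌊⌋-cong (subst (λ n → n ≤ N ⇔ (s < L (a , b) × L (a , b) + r ≤ N)) (xy∙z≈xz∙y se s r)
                      (cyclicSum-+-≤ r (s≤s z≤n) (lab≤N (a , b ℤ.+ -1ℤ)) south′)))
      where
      se : ℕ
      se = L (a , b ℤ.+ -1ℤ)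
      south′ : CyclicSum N se s (L (a , b))
      south′ = lab-north a (b ℤ.+ -1ℤ) s≤N refl (pred-suc b)

    adjacent-neighbour : ∀ v k → adjacent v (neighbour v k) ≡ sides N r s (L v) k
    adjacent-neighbour v k = trans (adjacent-+ᵥ v (offset k)) (arrows-offset v k)

corollary3p10 : (N r s : ℕ) .{{_ : NonZero N}} →
    1 ≤ r → r < s → 2 * s ≤ N → gcd (gcd r s) N ≡ 1 →
    (v : Vertex) →
    (((lab N r s v ≤ r ⊎ suc (N ∸ r) ≤ lab N r s v) → Fin 4 ↔ FaceSides N r s v)
    × (¬ (lab N r s v ≤ r ⊎ suc (N ∸ r) ≤ lab N r s v) → Fin 6 ↔ FaceSides N r s v))
corollary3p10 N r s 1≤r r<s 2s≤N _ v =
    (λ corner  → Fin↔FaceSides (trans count-sides (sides-square N r s r<s s+s≤N corner)))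
  , (λ ¬corner → Fin↔FaceSides (trans count-sides (sides-hexagon N r s r<s s+s≤N ¬corner)))
  where
  s+s≤N : s + s ≤ N
  s+s≤N = subst (_≤ N) (cong (λ t → s + t) (+-identityʳ s)) 2s≤N
  s<N : s < N
  s<N = <-≤-trans (m<m+n s (<-trans 1≤r r<s)) s+s≤N
  count-sides : count (adjacent N r s v ∘ neighbour v) ≡ count (sides N r s (lab N r s v))
  count-sides = count-cong (adjacent-neighbour N r s 1≤r r<s s<N v)
  Fin↔FaceSides : ∀ {m} → count (adjacent N r s v ∘ neighbour v) ≡ m → Fin m ↔ FaceSides N r s v
  Fin↔FaceSides refl = ↔-sym (FaceSides↔Fin-count N r s v)
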